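{- For every Dyck path $P$, the $F$-orbit of $P$, i.e. the set $\{F^m(P): m\ge 0\}$, has cardinality a power of $2$.
   Context: Dyck paths are words in the letters $U$ (upstep $(1,1)$) and $D$ (downstep $(1,-1)$) with equally many $U$'s and $D$'s such that every prefix contains at least as many $U$'s as $D$'s. The size of a Dyck path is its number of $U$'s; $\epsilon$ denotes the empty path; powers denote repetition, e.g. $(UD)^i$. A nonempty Dyck path is primitive if no nonempty proper prefix of it is a Dyck path; every nonempty Dyck path is uniquely a concatenation of primitive Dyck paths, its components. The map $F$ on Dyck paths is defined recursively: $F(\epsilon)=\epsilon$; if $P$ has components $P_1,\dots,P_r$ with $r\ge 2$ then $F(P)=F(P_1)F(P_2)\cdots F(P_r)$ (concatenation); every primitive $P$ can be written uniquely as $P=UQ(UD)^iD$ with $i\ge 0$ and $Q$ a Dyck path that is either empty or ends with $DD$, and then $F(P)=U^{i+1}F(R)\,UD\,D^{i+1}$ if $Q$ is primitive, say $Q=URD$, while $F(P)=U^{i+1}F(Q)D^{i+1}$ if $Q$ is not primitive (including $Q=\epsilon$). $F$ is a size-preserving bijection on Dyck paths. -}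

module Defs where

open import Data.Nat using (ℕ; zero; suc)
open import Data.Bool using (Bool; true; false)
open import Data.List using (List; []; _∷_; _++_; reverse; drop; length; replicate)
open import Data.Product using (_×_; _,_)
open import Relation.Binary.PropositionalEquality using (_≡_)

-- Steps of a lattice path: U = (1,1), D = (1,-1).
data Step : Set where
  U D : Step

dyckFrom : ℕ → List Step → Bool
dyckFrom zero    []      = true
dyckFrom (suc _) []      = false
dyckFrom h       (U ∷ w) = dyckFrom (suc h) w
dyckFrom zero    (D ∷ w) = false
dyckFrom (suc h) (D ∷ w) = dyckFrom h w

IsDyck : List Step → Set
IsDyck w = dyckFrom 0 w ≡ true

-- splitRet h w : current height is h ≥ 1; returns (prefix up to and
-- including the first return to height 0, remainder).
splitRet : ℕ → List Step → List Step × List Step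
splitRet h [] = [] , []
splitRet h (U ∷ w) with splitRet (suc h) w
... | a , b = U ∷ a , b
splitRet zero (D ∷ w) = D ∷ [] , w
splitRet (suc zero) (D ∷ w) = D ∷ [] , w
splitRet (suc (suc h)) (D ∷ w) with splitRet (suc h) w
... | a , b = D ∷ a , b

-- Decomposition of a Dyck path into its components (primitive factors).
-- The first argument is fuel (the length of the word suffices).
componentsF : ℕ → List Step → List (List Step)
componentsF zero    [] = []
componentsF zero    w = w ∷ []
componentsF (suc n) [] = []
componentsF (suc n) (D ∷ w) = (D ∷ w) ∷ []          -- unreachable on Dyck paths
componentsF (suc n) (U ∷ w) with splitRet 1 w
... | a , b = (U ∷ a) ∷ componentsF n b

components : List Step → List (List Step)
components w = componentsF (suc (length w)) w

inner : List Step → List Step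
inner p = reverse (drop 1 (reverse (drop 1 p)))

-- stripRev (reverse W) = (i , reverse Q) where W = Q (UD)^i and Q does
-- not end with UD (so Q is empty or ends with DD when W is Dyck).
stripRev : List Step → ℕ × List Step
stripRev (D ∷ U ∷ w) with stripRev w
... | i , q = suc i , q
stripRev w = 0 , w

mutual
  Ff : ℕ → List Step → List Step
  Ff zero w = w
  Ff (suc n) w = Fcomps n (components w)

  Fcomps : ℕ → List (List Step) → List Step
  Fcomps n [] = []
  Fcomps n (p ∷ []) = Fprim n p
  Fcomps n (p ∷ q ∷ ps) = Fall n (p ∷ q ∷ ps)

  Fall : ℕ → List (List Step) → List Step
  Fall n [] = []
  Fall n (p ∷ ps) = Ff n p ++ Fall n ps

  -- P = U Q (UD)^i D primitive.
  Fprim : ℕ → List Step → List Step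
  Fprim n p with stripRev (reverse (inner p))
  ... | i , rq = Fbody n i (reverse rq)

  Fbody : ℕ → ℕ → List Step → List Step
  Fbody n i q with components q
  ... | q₁ ∷ [] = replicate (suc i) U ++ Ff n (inner q₁) ++ (U ∷ D ∷ []) ++ replicate (suc i) D
  ... | _       = replicate (suc i) U ++ Ff n q ++ replicate (suc i) D

F : List Step → List Step
F w = Ff (suc (length w)) w

iter : {A : Set} → (A → A) → ℕ → A → A
iter f zero    x = x
iter f (suc m) x = f (iter f m x)

-- Let G be the map with F (U X D) = U (G X) D. Splitting off the last
-- component of a Dyck path gives three kinds of nonempty paths: on Z·UD, F acts
-- as F on Z and G sends it to U (G Z) D; on U S D, F acts as G on S and G sends
-- it to F(S)·UD; on X·U S D with X and S nonempty, both F and G act as F on X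
-- and as G on S. Hence any word w in F and G exchanges the two embeddings
-- Z ↦ Z·UD and S ↦ U S D while acting inside by another word, and w applied
-- twice preserves the embedding. Induction over this decomposition shows that
-- every such word has a power-of-two period at every Dyck path, and an orbit
-- whose period divides 2^k has a power of two elements.
module Submission where

open import Defs
open import Data.Bool using (Bool; true; false; _xor_)
open import Data.Bool.Properties using (xor-assoc; xor-same)
open import Data.Nat using (ℕ; zero; suc; pred; _+_; _*_; _^_; _∸_; _%_; _/_; _<_; _≤_; z≤n; s≤s; z<s; >-nonZero)
open import Data.Nat.Properties
open import Data.Nat.Coprimality using (Coprime; coprime-divisor)
open import Data.Nat.Divisibility using (_∣_; divides; _∣?_; ∣⇒≤; 0∣⇒≡0; ∣1⇒≡1; *-cancelʳ-∣; m%n≡0⇒n∣m; ∣m⇒∣m*n; m∣m*n; n∣m*n)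
open import Data.Nat.DivMod using (m≡m%n+[m/n]*n; m%n<n)
open import Data.Nat.Induction using (<-rec)
open import Data.List using (List; []; _∷_; _++_; reverse; drop; length; replicate; concat; foldr; applyUpTo)
open import Data.List.Properties
open import Data.List.Membership.Propositional using (_∈_)
open import Data.List.Membership.Propositional.Properties using (∈-applyUpTo⁺; ∈-applyUpTo⁻)
open import Data.List.Relation.Unary.All as All using (All; []; _∷_)
open import Data.List.Relation.Unary.Unique.Propositional using (Unique)
open import Data.List.Relation.Unary.Unique.Propositional.Properties using (applyUpTo⁺₁)
open import Data.Product using (_×_; _,_; proj₁; proj₂; ∃-syntax)
open import Data.Sum using (_⊎_; inj₁; inj₂)
open import Function using (_∘_)
open import Function.Bundles using (_⇔_; mk⇔)
open import Relation.Binary.Definitions using (DecidableEquality)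
open import Relation.Binary.PropositionalEquality
open import Relation.Nullary using (¬_; yes; no; contradiction)

iter-+ : ∀ {A : Set} (f : A → A) m n x → iter f (m + n) x ≡ iter f m (iter f n x)
iter-+ f zero n x = refl
iter-+ f (suc m) n x = cong f (iter-+ f m n x)

iter-* : ∀ {A : Set} (f : A → A) m n x → iter f (m * n) x ≡ iter (iter f n) m x
iter-* f zero n x = refl
iter-* f (suc m) n x = trans (iter-+ f n (m * n) x) (cong (iter f n) (iter-* f m n x))

iter-fixed-* : ∀ {A : Set} (f : A → A) {p x} → iter f p x ≡ x → ∀ m → iter f (m * p) x ≡ x
iter-fixed-* f {p} {x} fix m = trans (iter-* f m p x) (iter-fixed m)
  where
  iter-fixed : ∀ m → iter (iter f p) m x ≡ x
  iter-fixed zero = refl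
  iter-fixed (suc m) = trans (cong (iter f p) (iter-fixed m)) fix

iter-fixed-∣ : ∀ {A : Set} (f : A → A) {p n x} → iter f p x ≡ x → p ∣ n → iter f n x ≡ x
iter-fixed-∣ f fix (divides m refl) = iter-fixed-* f fix m

iter-preserves : ∀ {A : Set} (P : A → Set) {f : A → A} → (∀ {y} → P y → P (f y)) → ∀ n {x} → P x → P (iter f n x)
iter-preserves P f-pres zero Px = Px
iter-preserves P f-pres (suc n) Px = f-pres (iter-preserves P f-pres n Px)

iter-semiconj : ∀ {A B : Set} (P : A → Set) {g : B → B} {h : A → A} {e : A → B} →
  (∀ {z} → P z → P (h z)) → (∀ {z} → P z → g (e z) ≡ e (h z)) → ∀ n {z} → P z → iter g n (e z) ≡ e (iter h n z)
iter-semiconj P h-pres commute zero Pz = refl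
iter-semiconj P {g} h-pres commute (suc n) Pz =
  trans (cong g (iter-semiconj P h-pres commute n Pz)) (commute (iter-preserves P h-pres n Pz))

PowerOfTwoPeriodic : ∀ {A : Set} → (A → A) → A → Set
PowerOfTwoPeriodic f x = ∃[ k ] iter f (2 ^ k) x ≡ x

odd⇒coprime-2 : ∀ {d} → ¬ (2 ∣ d) → Coprime d 2
odd⇒coprime-2 2∤d {i} (i∣d , i∣2) with ∣⇒≤ i∣2
... | z≤n = contradiction (0∣⇒≡0 i∣2) λ ()
... | s≤s z≤n = refl
... | s≤s (s≤s z≤n) = contradiction i∣d 2∤d

∣2^⇒≡2^ : ∀ k {d} → d ∣ 2 ^ k → ∃[ j ] d ≡ 2 ^ j
∣2^⇒≡2^ zero d∣1 = 0 , ∣1⇒≡1 d∣1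
∣2^⇒≡2^ (suc k) {d} d∣2^1+k with 2 ∣? d
... | no 2∤d = ∣2^⇒≡2^ k (coprime-divisor (odd⇒coprime-2 2∤d) d∣2^1+k)
... | yes (divides q refl) with ∣2^⇒≡2^ k {q} (*-cancelʳ-∣ 2 (subst (q * 2 ∣_) (*-comm 2 (2 ^ k)) d∣2^1+k))
...   | j , refl = suc j , *-comm (2 ^ j) 2

module _ {A : Set} (f : A → A) (x : A) where

  ReturnsAfter : ℕ → Set
  ReturnsAfter m = iter f (suc m) x ≡ x

  LeastReturn : Set
  LeastReturn = ∃[ m ] (ReturnsAfter m × (∀ j → j < m → ¬ ReturnsAfter j))

  least-return : DecidableEquality A → ∀ n → ReturnsAfter n → LeastReturn
  least-return _≟_ = <-rec (λ n → ReturnsAfter n → LeastReturn) search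
    where
    search : ∀ n → (∀ {m} → m < n → ReturnsAfter m → LeastReturn) → ReturnsAfter n → LeastReturn
    search n earlier returns with anyUpTo? (λ m → iter f (suc m) x ≟ x) n
    ... | yes (m , m<n , returnsₘ) = earlier m<n returnsₘ
    ... | no none = n , returns , λ j j<n returnsⱼ → none (j , j<n , returnsⱼ)

  module MinimalPeriod (m : ℕ) (returns : ReturnsAfter m) (minimal : ∀ j → j < m → ¬ ReturnsAfter j) where

    orbit-injective : ∀ {i j} → i < j → j < suc m → iter f i x ≢ iter f j x
    orbit-injective {i} {j} i<j (s≤s j≤m) fᶦx≡fʲx = minimal (m ∸ j + i) shorter returns-early
      where
      shorter : m ∸ j + i < m
      shorter = subst (m ∸ j + i <_) (m∸n+n≡m j≤m) (+-monoʳ-< (m ∸ j) i<j)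
      returns-early : ReturnsAfter (m ∸ j + i)
      returns-early = begin
        iter f (suc (m ∸ j) + i) x         ≡⟨ iter-+ f (suc (m ∸ j)) i x ⟩
        iter f (suc (m ∸ j)) (iter f i x)  ≡⟨ cong (iter f (suc (m ∸ j))) fᶦx≡fʲx ⟩
        iter f (suc (m ∸ j)) (iter f j x)  ≡⟨ iter-+ f (suc (m ∸ j)) j x ⟨
        iter f (suc (m ∸ j + j)) x         ≡⟨ cong (λ k → iter f (suc k) x) (m∸n+n≡m j≤m) ⟩
        iter f (suc m) x                   ≡⟨ returns ⟩
        x                                  ∎
        where open ≡-Reasoning

    orbit-mod : ∀ n → iter f n x ≡ iter f (n % suc m) x
    orbit-mod n = begin
      iter f n x                                        ≡⟨ cong (λ k → iter f k x) (m≡m%n+[m/n]*n n (suc m)) ⟩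
      iter f (n % suc m + n / suc m * suc m) x          ≡⟨ iter-+ f (n % suc m) (n / suc m * suc m) x ⟩
      iter f (n % suc m) (iter f (n / suc m * suc m) x) ≡⟨ cong (iter f (n % suc m)) (iter-fixed-* f returns (n / suc m)) ⟩
      iter f (n % suc m) x                              ∎
      where open ≡-Reasoning

    period-∣ : ∀ n → iter f n x ≡ x → suc m ∣ n
    period-∣ n fⁿx≡x = m%n≡0⇒n∣m n (suc m) (remainder-zero (n % suc m) refl (m%n<n n (suc m)))
      where
      remainder-zero : ∀ r → n % suc m ≡ r → r < suc m → r ≡ 0
      remainder-zero zero _ _ = refl
      remainder-zero (suc r) n%p≡1+r (s≤s r<m) =
        contradiction (trans (sym (trans (orbit-mod n) (cong (λ k → iter f k x) n%p≡1+r))) fⁿx≡x) (minimal r r<m)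

    point : ℕ → A
    point n = iter f n x

    orbit : List A
    orbit = applyUpTo point (suc m)

    orbit-unique : Unique orbit
    orbit-unique = applyUpTo⁺₁ point (suc m) orbit-injective

    ∈-orbit⇔ : (X : A) → X ∈ orbit ⇔ (∃[ n ] iter f n x ≡ X)
    ∈-orbit⇔ X = mk⇔ from to
      where
      from : X ∈ orbit → ∃[ n ] iter f n x ≡ X
      from X∈orbit with n , _ , refl ← ∈-applyUpTo⁻ point X∈orbit = n , refl
      to : ∃[ n ] iter f n x ≡ X → X ∈ orbit
      to (n , refl) = subst (_∈ orbit) (sym (orbit-mod n)) (∈-applyUpTo⁺ point (m%n<n n (suc m)))

  orbit-size-2^ : DecidableEquality A → PowerOfTwoPeriodic f x →
    ∃[ j ] ∃[ L ] (Unique L × length L ≡ 2 ^ j × ((X : A) → (X ∈ L ⇔ (∃[ n ] iter f n x ≡ X))))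
  orbit-size-2^ _≟_ (k , f²ᵏx≡x) with least-return _≟_ (pred (2 ^ k)) returns-after-2^k
    where
    returns-after-2^k : ReturnsAfter (pred (2 ^ k))
    returns-after-2^k = subst (λ n → iter f n x ≡ x) (sym (suc-pred (2 ^ k) {{>-nonZero (m^n>0 2 k)}})) f²ᵏx≡x
  ... | m , returns , minimal =
    let j , 1+m≡2^j = ∣2^⇒≡2^ k (period-∣ (2 ^ k) f²ᵏx≡x)
    in j , orbit , orbit-unique , trans (length-applyUpTo point (suc m)) 1+m≡2^j , ∈-orbit⇔
    where open MinimalPeriod m returns minimal

length-++-<ˡ : ∀ {A : Set} (xs : List A) {ys} → ys ≢ [] → length xs < length (xs ++ ys)
length-++-<ˡ xs {[]} ys≢[] = contradiction refl ys≢[]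
length-++-<ˡ xs {y ∷ ys} _ = subst (length xs <_) (sym (length-++ xs)) (m<m+n (length xs) z<s)

length-++-<ʳ : ∀ {A : Set} {xs : List A} ys → xs ≢ [] → length ys < length (xs ++ ys)
length-++-<ʳ {xs = []} ys xs≢[] = contradiction refl xs≢[]
length-++-<ʳ {xs = x ∷ xs} ys _ = s≤s (length-++-≤ʳ ys {xs})

++-≢[]ˡ : ∀ {A : Set} {xs ys : List A} → xs ≢ [] → xs ++ ys ≢ []
++-≢[]ˡ {xs = []} xs≢[] = contradiction refl xs≢[]
++-≢[]ˡ {xs = x ∷ xs} _ = λ ()

++-≢[]ʳ : ∀ {A : Set} {xs ys : List A} → ys ≢ [] → xs ++ ys ≢ []
++-≢[]ʳ {xs = []} ys≢[] = ys≢[]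
++-≢[]ʳ {xs = x ∷ xs} _ = λ ()

splitRet-++ : ∀ h w → proj₁ (splitRet h w) ++ proj₂ (splitRet h w) ≡ w
splitRet-++ h [] = refl
splitRet-++ h (U ∷ w) with splitRet (suc h) w | splitRet-++ (suc h) w
... | a , b | a++b≡w = cong (U ∷_) a++b≡w
splitRet-++ zero (D ∷ w) = refl
splitRet-++ (suc zero) (D ∷ w) = refl
splitRet-++ (suc (suc h)) (D ∷ w) with splitRet (suc h) w | splitRet-++ (suc h) w
... | a , b | a++b≡w = cong (D ∷_) a++b≡w

length-splitRet-rest : ∀ h w → length (proj₂ (splitRet h w)) ≤ length w
length-splitRet-rest h w = subst (λ v → length (proj₂ (splitRet h w)) ≤ length v) (splitRet-++ h w)
  (length-++-≤ʳ (proj₂ (splitRet h w)) {proj₁ (splitRet h w)})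

concat-componentsF : ∀ n w → concat (componentsF n w) ≡ w
concat-componentsF zero [] = refl
concat-componentsF zero (x ∷ w) = ++-identityʳ (x ∷ w)
concat-componentsF (suc n) [] = refl
concat-componentsF (suc n) (D ∷ w) = cong (D ∷_) (++-identityʳ w)
concat-componentsF (suc n) (U ∷ w) with splitRet 1 w | splitRet-++ 1 w
... | a , b | a++b≡w = cong (U ∷_) (trans (cong (a ++_) (concat-componentsF n b)) a++b≡w)

componentsF-nonempty : ∀ n w → All (_≢ []) (componentsF n w)
componentsF-nonempty zero [] = []
componentsF-nonempty zero (x ∷ w) = (λ ()) ∷ []
componentsF-nonempty (suc n) [] = []
componentsF-nonempty (suc n) (D ∷ w) = (λ ()) ∷ []
componentsF-nonempty (suc n) (U ∷ w) with splitRet 1 w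
... | a , b = (λ ()) ∷ componentsF-nonempty n b

componentsF-fuel : ∀ n m w → length w < n → length w < m → componentsF n w ≡ componentsF m w
componentsF-fuel (suc n) (suc m) [] _ _ = refl
componentsF-fuel (suc n) (suc m) (D ∷ w) _ _ = refl
componentsF-fuel (suc n) (suc m) (U ∷ w) (s≤s w<n) (s≤s w<m) with splitRet 1 w | length-splitRet-rest 1 w
... | a , b | b≤w = cong ((U ∷ a) ∷_) (componentsF-fuel n m b (≤-<-trans b≤w w<n) (≤-<-trans b≤w w<m))

concat-components : ∀ w → concat (components w) ≡ w
concat-components w = concat-componentsF (suc (length w)) w

components-singleton : ∀ {w c} → components w ≡ c ∷ [] → c ≡ w
components-singleton {w} {c} eq = trans (sym (++-identityʳ c)) (trans (cong concat (sym eq)) (concat-components w))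

length-concat-≤ : ∀ {A : Set} (cs : List (List A)) → All (λ x → length x ≤ length (concat cs)) cs
length-concat-≤ [] = []
length-concat-≤ (c ∷ cs) = length-++-≤ˡ c ∷ All.map (λ x≤cs → ≤-trans x≤cs (length-++-≤ʳ (concat cs) {c})) (length-concat-≤ cs)

components-shorter : ∀ {w c d ds} → components w ≡ c ∷ d ∷ ds → All (λ x → length x < length w) (c ∷ d ∷ ds)
components-shorter {w} {c} {d} {ds} eq with subst (All (_≢ [])) eq (componentsF-nonempty (suc (length w)) w)
... | c≢[] ∷ d≢[] ∷ _ = subst (λ v → All (λ x → length x < length v) (c ∷ d ∷ ds)) concat≡w
  (length-++-<ˡ c (++-≢[]ˡ d≢[]) ∷ All.map (λ x≤ → ≤-trans (s≤s x≤) (length-++-<ʳ (concat (d ∷ ds)) c≢[])) (length-concat-≤ (d ∷ ds)))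
  where
  concat≡w : concat (c ∷ d ∷ ds) ≡ w
  concat≡w = trans (cong concat (sym eq)) (concat-components w)

length-inner : ∀ x xs → length (inner (x ∷ xs)) ≤ length xs
length-inner x xs = begin
  length (reverse (drop 1 (reverse xs))) ≡⟨ length-reverse (drop 1 (reverse xs)) ⟩
  length (drop 1 (reverse xs))           ≡⟨ length-drop 1 (reverse xs) ⟩
  length (reverse xs) ∸ 1                ≤⟨ m∸n≤m _ 1 ⟩
  length (reverse xs)                    ≡⟨ length-reverse xs ⟩
  length xs                              ∎
  where open ≤-Reasoning

length-inner-≤ : ∀ c → length (inner c) ≤ length c
length-inner-≤ [] = z≤n
length-inner-≤ (x ∷ xs) = m≤n⇒m≤1+n (length-inner x xs)

length-stripRev : ∀ w → length (proj₂ (stripRev w)) ≤ length w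
length-stripRev (D ∷ U ∷ w) = m≤n⇒m≤1+n (m≤n⇒m≤1+n (length-stripRev w))
length-stripRev [] = ≤-refl
length-stripRev (U ∷ w) = ≤-refl
length-stripRev (D ∷ []) = ≤-refl
length-stripRev (D ∷ D ∷ w) = ≤-refl

Fall-cong : ∀ {n m} cs → All (λ x → Ff n x ≡ Ff m x) cs → Fall n cs ≡ Fall m cs
Fall-cong [] [] = refl
Fall-cong (c ∷ cs) (eq ∷ eqs) = cong₂ _++_ eq (Fall-cong cs eqs)

module _ {n m : ℕ} where

  Fbody-cong : ∀ i q → (∀ x → length x ≤ length q → Ff n x ≡ Ff m x) → Fbody n i q ≡ Fbody m i q
  Fbody-cong i q agree with components q in eq
  ... | [] = cong (λ z → replicate (suc i) U ++ z ++ replicate (suc i) D) (agree q ≤-refl)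
  ... | c ∷ d ∷ ds = cong (λ z → replicate (suc i) U ++ z ++ replicate (suc i) D) (agree q ≤-refl)
  ... | q₁ ∷ [] with components-singleton eq
  ...   | refl = cong (λ z → replicate (suc i) U ++ z ++ U ∷ D ∷ replicate (suc i) D) (agree (inner q₁) (length-inner-≤ q₁))

  Fprim-cong : ∀ x xs → (∀ y → length y < length (x ∷ xs) → Ff n y ≡ Ff m y) → Fprim n (x ∷ xs) ≡ Fprim m (x ∷ xs)
  Fprim-cong x xs agree with stripRev (reverse (inner (x ∷ xs))) | length-stripRev (reverse (inner (x ∷ xs)))
  ... | i , rq | rq≤ = Fbody-cong i (reverse rq) λ y y≤q → agree y (s≤s (begin
    length y                      ≤⟨ y≤q ⟩
    length (reverse rq)           ≡⟨ length-reverse rq ⟩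
    length rq                     ≤⟨ rq≤ ⟩
    length (reverse (inner (x ∷ xs))) ≡⟨ length-reverse (inner (x ∷ xs)) ⟩
    length (inner (x ∷ xs))       ≤⟨ length-inner x xs ⟩
    length xs                     ∎))
    where open ≤-Reasoning

  Fcomps-cong : ∀ w → (∀ x → length x < length w → Ff n x ≡ Ff m x) → Fcomps n (components w) ≡ Fcomps m (components w)
  Fcomps-cong [] agree = refl
  Fcomps-cong (x ∷ xs) agree with components (x ∷ xs) in eq
  ... | [] = refl
  ... | c ∷ d ∷ ds = Fall-cong {n} {m} (c ∷ d ∷ ds) (All.map (λ {y} → agree y) (components-shorter eq))
  ... | c ∷ [] with components-singleton eq
  ...   | refl = Fprim-cong x xs agree

Ff-fuel : ∀ n m w → length w < n → length w < m → Ff n w ≡ Ff m w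
Ff-fuel (suc n) (suc m) w (s≤s w≤n) (s≤s w≤m) =
  Fcomps-cong w (λ x x<w → Ff-fuel n m x (<-≤-trans x<w w≤n) (<-≤-trans x<w w≤m))

Ff≡F : ∀ n w → length w < n → Ff n w ≡ F w
Ff≡F n w w<n = Ff-fuel n (suc (length w)) w w<n ≤-refl

UD : List Step
UD = U ∷ D ∷ []

wrap : List Step → List Step
wrap S = U ∷ S ++ D ∷ []

dyckFrom-++ : ∀ k j A B → dyckFrom k A ≡ true → dyckFrom j B ≡ true → dyckFrom (k + j) (A ++ B) ≡ true
dyckFrom-++ zero j [] B _ B-ok = B-ok
dyckFrom-++ zero zero (U ∷ A) B A-ok B-ok = dyckFrom-++ 1 0 A B A-ok B-ok
dyckFrom-++ zero (suc j) (U ∷ A) B A-ok B-ok = dyckFrom-++ 1 (suc j) A B A-ok B-ok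
dyckFrom-++ (suc k) j (U ∷ A) B A-ok B-ok = dyckFrom-++ (suc (suc k)) j A B A-ok B-ok
dyckFrom-++ (suc k) j (D ∷ A) B A-ok B-ok = dyckFrom-++ k j A B A-ok B-ok

dyck-++ : ∀ {A B} → IsDyck A → IsDyck B → IsDyck (A ++ B)
dyck-++ {A} {B} = dyckFrom-++ 0 0 A B

dyck-cons : ∀ {S Y} → IsDyck S → IsDyck Y → IsDyck (U ∷ S ++ D ∷ Y)
dyck-cons {S} {Y} = dyckFrom-++ 0 1 S (D ∷ Y)

dyck-wrap : ∀ {S} → IsDyck S → IsDyck (wrap S)
dyck-wrap {S} S-ok = dyck-cons {S} {[]} S-ok refl

splitRet-first-return : ∀ k S r → dyckFrom k S ≡ true → splitRet (suc k) (S ++ D ∷ r) ≡ (S ++ D ∷ [] , r)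
splitRet-first-return zero [] r _ = refl
splitRet-first-return zero (U ∷ S) r S-ok rewrite splitRet-first-return 1 S r S-ok = refl
splitRet-first-return (suc k) (U ∷ S) r S-ok rewrite splitRet-first-return (suc (suc k)) S r S-ok = refl
splitRet-first-return (suc k) (D ∷ S) r S-ok rewrite splitRet-first-return k S r S-ok = refl

first-return : ∀ k w → dyckFrom (suc k) w ≡ true →
  ∃[ S ] ∃[ r ] (w ≡ S ++ D ∷ r × dyckFrom k S ≡ true × IsDyck r)
first-return zero (U ∷ w) w-ok with first-return 1 w w-ok
... | S , r , refl , S-ok , r-ok = U ∷ S , r , refl , S-ok , r-ok
first-return (suc k) (U ∷ w) w-ok with first-return (suc (suc k)) w w-ok
... | S , r , refl , S-ok , r-ok = U ∷ S , r , refl , S-ok , r-ok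
first-return zero (D ∷ w) w-ok = [] , w , refl , refl , w-ok
first-return (suc k) (D ∷ w) w-ok with first-return k w w-ok
... | S , r , refl , S-ok , r-ok = D ∷ S , r , refl , S-ok , r-ok

length-cons-tail : ∀ S Y → length Y < length (U ∷ S ++ D ∷ Y)
length-cons-tail S Y = m≤n⇒m≤1+n (length-++-≤ʳ (D ∷ Y) {S})

components-cons : ∀ S Y → IsDyck S → components (U ∷ S ++ D ∷ Y) ≡ wrap S ∷ components Y
components-cons S Y S-ok rewrite splitRet-first-return 0 S Y S-ok =
  cong (wrap S ∷_) (componentsF-fuel _ _ Y (length-cons-tail S Y) ≤-refl)

data FirstReturn : List Step → Set where
  ε : FirstReturn []
  return : ∀ {S Y} → IsDyck S → FirstReturn Y → FirstReturn (U ∷ S ++ D ∷ Y)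

firstReturn′ : ∀ n w → length w < n → IsDyck w → FirstReturn w
firstReturn′ n [] _ _ = ε
firstReturn′ (suc n) (U ∷ w) (s≤s Uw≤n) w-ok with first-return 0 w w-ok
... | S , Y , refl , S-ok , Y-ok = return S-ok (firstReturn′ n Y (<-≤-trans (length-cons-tail S Y) Uw≤n) Y-ok)

firstReturn : ∀ {w} → IsDyck w → FirstReturn w
firstReturn {w} = firstReturn′ (suc (length w)) w ≤-refl

last-component : ∀ {Y} → FirstReturn Y → Y ≡ [] ⊎ ∃[ X ] ∃[ S ] (IsDyck X × IsDyck S × Y ≡ X ++ wrap S)
last-component ε = inj₁ refl
last-component (return {S} {Y} S-ok v) with last-component v
... | inj₁ refl = inj₂ ([] , S , refl , S-ok , refl)
... | inj₂ (X , T , X-ok , T-ok , refl) =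
  inj₂ (U ∷ S ++ D ∷ X , T , dyck-cons {S} {X} S-ok X-ok , T-ok , cong (U ∷_) (sym (++-assoc S (D ∷ X) (wrap T))))

wrap-++ : ∀ S Y → wrap S ++ Y ≡ U ∷ S ++ D ∷ Y
wrap-++ S Y = cong (U ∷_) (++-assoc S (D ∷ []) Y)

components-≢[] : ∀ {w} → w ≢ [] → components w ≢ []
components-≢[] {w} w≢[] eq = w≢[] (trans (sym (concat-components w)) (cong concat eq))

Fcomps-∷ : ∀ n p ps → ps ≢ [] → Fcomps n (p ∷ ps) ≡ Ff n p ++ Fall n ps
Fcomps-∷ n p [] ps≢[] = contradiction refl ps≢[]
Fcomps-∷ n p (q ∷ qs) _ = refl

Fall-components : ∀ N w → length w < N → Fall N (components w) ≡ F w
Fall-components N w w<N = go (components w) refl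
  where
  go : ∀ cs → components w ≡ cs → Fall N cs ≡ Fcomps (length w) cs
  go [] _ = refl
  go (c ∷ []) eq with components-singleton eq
  ... | refl = trans (++-identityʳ (Ff N c)) (trans (Ff≡F N c w<N) (cong (Fcomps (length c)) eq))
  go (c ∷ d ∷ ds) eq = Fall-cong {N} {length w} (c ∷ d ∷ ds)
    (All.map (λ {x} x<w → trans (Ff≡F N x (<-trans x<w w<N)) (sym (Ff≡F (length w) x x<w))) (components-shorter eq))

F-cons : ∀ S Y → IsDyck S → F (U ∷ S ++ D ∷ Y) ≡ F (wrap S) ++ F Y
F-cons S [] _ = sym (++-identityʳ (F (wrap S)))
F-cons S Y@(_ ∷ _) S-ok = begin
  F (U ∷ S ++ D ∷ Y)                      ≡⟨ cong (Fcomps L) (components-cons S Y S-ok) ⟩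
  Fcomps L (wrap S ∷ components Y)        ≡⟨ Fcomps-∷ L (wrap S) (components Y) (components-≢[] λ ()) ⟩
  Ff L (wrap S) ++ Fall L (components Y)  ≡⟨ cong₂ _++_ (Ff≡F L (wrap S) wrap<L) (Fall-components L Y (length-cons-tail S Y)) ⟩
  F (wrap S) ++ F Y                       ∎
  where
  open ≡-Reasoning
  L : ℕ
  L = length (U ∷ S ++ D ∷ Y)
  wrap<L : length (wrap S) < L
  wrap<L = subst (λ v → length (wrap S) < length v) (wrap-++ S Y) (length-++-<ˡ (wrap S) λ ())

F-++ : ∀ {X} → FirstReturn X → ∀ Y → F (X ++ Y) ≡ F X ++ F Y
F-++ ε Y = refl
F-++ (return {S} {X} S-ok v) Y = begin
  F ((U ∷ S ++ D ∷ X) ++ Y)       ≡⟨ cong (λ z → F (U ∷ z)) (++-assoc S (D ∷ X) Y) ⟩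
  F (U ∷ S ++ D ∷ X ++ Y)         ≡⟨ F-cons S (X ++ Y) S-ok ⟩
  F (wrap S) ++ F (X ++ Y)        ≡⟨ cong (F (wrap S) ++_) (F-++ v Y) ⟩
  F (wrap S) ++ F X ++ F Y        ≡⟨ ++-assoc (F (wrap S)) (F X) (F Y) ⟨
  (F (wrap S) ++ F X) ++ F Y      ≡⟨ cong (_++ F Y) (F-cons S X S-ok) ⟨
  F (U ∷ S ++ D ∷ X) ++ F Y       ∎
  where open ≡-Reasoning

-- Writing X = Q (UD)^i as in the definition of F, G X is what F puts between
-- the outer U and D of U X D.
Gbody : ℕ → List Step → List (List Step) → List Step
Gbody i q (q₁ ∷ []) = replicate i U ++ (F (inner q₁) ++ UD) ++ replicate i D
Gbody i q _ = replicate i U ++ F q ++ replicate i D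

G : List Step → List Step
G X = Gbody (proj₁ (stripRev (reverse X))) Q (components Q)
  where
  Q : List Step
  Q = reverse (proj₂ (stripRev (reverse X)))

replicate-wrap : ∀ i M → replicate (suc i) U ++ M ++ replicate (suc i) D ≡ wrap (replicate i U ++ M ++ replicate i D)
replicate-wrap i M = cong (U ∷_) (begin
  replicate i U ++ M ++ replicate (suc i) D        ≡⟨ cong (λ z → replicate i U ++ M ++ z) (replicate-suc-∷ʳ i) ⟩
  replicate i U ++ M ++ replicate i D ++ D ∷ []    ≡⟨ cong (replicate i U ++_) (++-assoc M _ _) ⟨
  replicate i U ++ (M ++ replicate i D) ++ D ∷ []  ≡⟨ ++-assoc (replicate i U) _ _ ⟨
  (replicate i U ++ M ++ replicate i D) ++ D ∷ []  ∎)
  where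
  open ≡-Reasoning
  replicate-suc-∷ʳ : ∀ i → replicate (suc i) D ≡ replicate i D ++ D ∷ []
  replicate-suc-∷ʳ zero = refl
  replicate-suc-∷ʳ (suc i) = cong (D ∷_) (replicate-suc-∷ʳ i)

Fbody≡wrap-Gbody : ∀ n i q → length q < n → Fbody n i q ≡ wrap (Gbody i q (components q))
Fbody≡wrap-Gbody n i q q<n with components q in eq
... | [] = trans (cong (λ z → replicate (suc i) U ++ z ++ replicate (suc i) D) (Ff≡F n q q<n)) (replicate-wrap i (F q))
... | c ∷ d ∷ ds = trans (cong (λ z → replicate (suc i) U ++ z ++ replicate (suc i) D) (Ff≡F n q q<n)) (replicate-wrap i (F q))
... | q₁ ∷ [] with components-singleton eq
...   | refl = begin
  replicate (suc i) U ++ Ff n (inner q) ++ UD ++ replicate (suc i) D   ≡⟨ cong (λ z → replicate (suc i) U ++ z ++ UD ++ replicate (suc i) D) (Ff≡F n (inner q) (≤-<-trans (length-inner-≤ q) q<n)) ⟩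
  replicate (suc i) U ++ F (inner q) ++ UD ++ replicate (suc i) D      ≡⟨ cong (replicate (suc i) U ++_) (++-assoc (F (inner q)) UD _) ⟨
  replicate (suc i) U ++ (F (inner q) ++ UD) ++ replicate (suc i) D    ≡⟨ replicate-wrap i (F (inner q) ++ UD) ⟩
  wrap (replicate i U ++ (F (inner q) ++ UD) ++ replicate i D)         ∎
  where open ≡-Reasoning

Fprim≡wrap-G : ∀ n c → length (inner c) < n → Fprim n c ≡ wrap (G (inner c))
Fprim≡wrap-G n c inner<n with stripRev (reverse (inner c)) | length-stripRev (reverse (inner c))
... | i , rq | rq≤ = Fbody≡wrap-Gbody n i (reverse rq) (begin-strict
  length (reverse rq)           ≡⟨ length-reverse rq ⟩
  length rq                     ≤⟨ rq≤ ⟩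
  length (reverse (inner c))    ≡⟨ length-reverse (inner c) ⟩
  length (inner c)              <⟨ inner<n ⟩
  n                             ∎)
  where open ≤-Reasoning

inner-wrap : ∀ S → inner (wrap S) ≡ S
inner-wrap S = begin
  reverse (drop 1 (reverse (S ++ D ∷ [])))  ≡⟨ cong (λ z → reverse (drop 1 z)) (reverse-++ S (D ∷ [])) ⟩
  reverse (reverse S)                        ≡⟨ reverse-involutive S ⟩
  S                                          ∎
  where open ≡-Reasoning

F-wrap : ∀ {S} → IsDyck S → F (wrap S) ≡ wrap (G S)
F-wrap {S} S-ok = begin
  F (wrap S)                 ≡⟨ cong (Fcomps (length (wrap S))) (components-cons S [] S-ok) ⟩
  Fprim (length (wrap S)) (wrap S) ≡⟨ Fprim≡wrap-G _ (wrap S) (s≤s (length-inner U (S ++ D ∷ []))) ⟩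
  wrap (G (inner (wrap S)))  ≡⟨ cong (wrap ∘ G) (inner-wrap S) ⟩
  wrap (G S)                 ∎
  where open ≡-Reasoning

Gbody-suc : ∀ i q cs → Gbody (suc i) q cs ≡ wrap (Gbody i q cs)
Gbody-suc i q [] = replicate-wrap i (F q)
Gbody-suc i q (q₁ ∷ []) = replicate-wrap i (F (inner q₁) ++ UD)
Gbody-suc i q (c ∷ d ∷ ds) = replicate-wrap i (F q)

Gbody-∷ : ∀ i q c cs → cs ≢ [] → Gbody i q (c ∷ cs) ≡ replicate i U ++ F q ++ replicate i D
Gbody-∷ i q c [] cs≢[] = contradiction refl cs≢[]
Gbody-∷ i q c (d ∷ ds) _ = refl

G-++UD : ∀ Z → G (Z ++ UD) ≡ wrap (G Z)
G-++UD Z rewrite reverse-++ Z UD with stripRev (reverse Z)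
... | i , rq = Gbody-suc i (reverse rq) (components (reverse rq))

EndsDD : List Step → Set
EndsDD Y = ∃[ Y′ ] Y ≡ Y′ ++ D ∷ D ∷ []

G-EndsDD : ∀ {Y} → EndsDD Y → G Y ≡ Gbody 0 Y (components Y)
G-EndsDD (Y′ , refl) = trans
  (cong (λ s → Gbody (proj₁ s) (reverse (proj₂ s)) (components (reverse (proj₂ s)))) stripRev-DD)
  (cong (λ q → Gbody 0 q (components q)) (reverse-involutive (Y′ ++ D ∷ D ∷ [])))
  where
  stripRev-DD : stripRev (reverse (Y′ ++ D ∷ D ∷ [])) ≡ (0 , reverse (Y′ ++ D ∷ D ∷ []))
  stripRev-DD rewrite reverse-++ Y′ (D ∷ D ∷ []) = refl

wrap-EndsDD : ∀ {S} → IsDyck S → S ≢ [] → ∀ X → EndsDD (X ++ wrap S)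
wrap-EndsDD {S} S-ok S≢[] X with last-component (firstReturn {S} S-ok)
... | inj₁ S≡[] = contradiction S≡[] S≢[]
... | inj₂ (Z , T , _ , _ , refl) = X ++ U ∷ S′ , (begin
  X ++ U ∷ (Z ++ U ∷ T ++ D ∷ []) ++ D ∷ []  ≡⟨ cong (λ v → X ++ U ∷ v ++ D ∷ []) (++-assoc Z (U ∷ T) (D ∷ [])) ⟨
  X ++ U ∷ (S′ ++ D ∷ []) ++ D ∷ []          ≡⟨ cong (λ v → X ++ U ∷ v) (++-assoc S′ (D ∷ []) (D ∷ [])) ⟩
  X ++ U ∷ S′ ++ D ∷ D ∷ []                  ≡⟨ ++-assoc X (U ∷ S′) (D ∷ D ∷ []) ⟨
  (X ++ U ∷ S′) ++ D ∷ D ∷ []                ∎)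
  where
  open ≡-Reasoning
  S′ : List Step
  S′ = Z ++ U ∷ T

G-wrap : ∀ {S} → IsDyck S → G (wrap S) ≡ F S ++ UD
G-wrap {[]} _ = refl
G-wrap {S@(_ ∷ _)} S-ok = begin
  G (wrap S)                                ≡⟨ G-EndsDD (wrap-EndsDD {S} S-ok (λ ()) []) ⟩
  Gbody 0 (wrap S) (components (wrap S))    ≡⟨ cong (Gbody 0 (wrap S)) (components-cons S [] S-ok) ⟩
  (F (inner (wrap S)) ++ UD) ++ []          ≡⟨ ++-identityʳ _ ⟩
  F (inner (wrap S)) ++ UD                  ≡⟨ cong (λ v → F v ++ UD) (inner-wrap S) ⟩
  F S ++ UD                                 ∎
  where open ≡-Reasoning

G≡F-joined : ∀ {X S} → IsDyck X → X ≢ [] → IsDyck S → S ≢ [] → G (X ++ wrap S) ≡ F (X ++ wrap S)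
G≡F-joined {X} {S} X-ok X≢[] S-ok S≢[] with firstReturn {X} X-ok
... | ε = contradiction refl X≢[]
... | return {A} {B} A-ok _ = begin
  G Y                                       ≡⟨ G-EndsDD (wrap-EndsDD {S} S-ok S≢[] X) ⟩
  Gbody 0 Y (components Y)                  ≡⟨ cong (Gbody 0 Y) components-Y ⟩
  Gbody 0 Y (wrap A ∷ components (B ++ wrap S)) ≡⟨ Gbody-∷ 0 Y (wrap A) _ (components-≢[] (++-≢[]ʳ {xs = B} λ ())) ⟩
  F Y ++ []                                 ≡⟨ ++-identityʳ (F Y) ⟩
  F Y                                       ∎
  where
  open ≡-Reasoning
  Y : List Step
  Y = (U ∷ A ++ D ∷ B) ++ wrap S
  components-Y : components Y ≡ wrap A ∷ components (B ++ wrap S)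
  components-Y = trans (cong (components ∘ (U ∷_)) (++-assoc A (D ∷ B) (wrap S))) (components-cons A (B ++ wrap S) A-ok)

F-++UD : ∀ {Z} → IsDyck Z → F (Z ++ UD) ≡ F Z ++ UD
F-++UD {Z} Z-ok = F-++ (firstReturn {Z} Z-ok) UD

F-joined : ∀ {X S} → IsDyck X → IsDyck S → F (X ++ wrap S) ≡ F X ++ wrap (G S)
F-joined {X} {S} X-ok S-ok = trans (F-++ (firstReturn {X} X-ok) (wrap S)) (cong (F X ++_) (F-wrap {S} S-ok))

data Shape : List Step → Set where
  empty   : Shape []
  endsUD  : ∀ {Z} → Shape Z → Shape (Z ++ UD)
  wrapped : ∀ {S} → Shape S → Shape (wrap S)
  joined  : ∀ {X S} → Shape X → X ≢ [] → Shape S → S ≢ [] → Shape (X ++ wrap S)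

Shape⇒IsDyck : ∀ {Y} → Shape Y → IsDyck Y
Shape⇒IsDyck empty = refl
Shape⇒IsDyck (endsUD {Z} s) = dyck-++ {Z} {UD} (Shape⇒IsDyck s) refl
Shape⇒IsDyck (wrapped {S} s) = dyck-wrap {S} (Shape⇒IsDyck s)
Shape⇒IsDyck (joined {X} {S} sX _ sS _) = dyck-++ {X} {wrap S} (Shape⇒IsDyck sX) (dyck-wrap {S} (Shape⇒IsDyck sS))

length-<-++wrap : ∀ X S → length S < length (X ++ wrap S)
length-<-++wrap X S = <-≤-trans (s≤s (length-++-≤ˡ S)) (length-++-≤ʳ (wrap S) {X})

shape′ : ∀ n Y → length Y < n → IsDyck Y → Shape Y
shape′ (suc n) Y (s≤s Y≤n) Y-ok with last-component (firstReturn {Y} Y-ok)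
... | inj₁ refl = empty
... | inj₂ (X , [] , X-ok , _ , refl) = endsUD (shape′ n X (<-≤-trans (length-++-<ˡ X λ ()) Y≤n) X-ok)
... | inj₂ ([] , S@(_ ∷ _) , _ , S-ok , refl) = wrapped (shape′ n S (<-≤-trans (length-<-++wrap [] S) Y≤n) S-ok)
... | inj₂ (X@(_ ∷ _) , S@(_ ∷ _) , X-ok , S-ok , refl) =
  joined (shape′ n X (<-≤-trans (length-++-<ˡ X λ ()) Y≤n) X-ok) (λ ()) (shape′ n S (<-≤-trans (length-<-++wrap X S) Y≤n) S-ok) (λ ())

shape : ∀ {Y} → IsDyck Y → Shape Y
shape {Y} = shape′ (suc (length Y)) Y ≤-refl

NonEmptyDyck : List Step → Set
NonEmptyDyck Y = IsDyck Y × Y ≢ []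

F-G-dyck : ∀ {Y} → Shape Y → IsDyck (F Y) × IsDyck (G Y)
F-G-dyck empty = refl , refl
F-G-dyck (endsUD {Z} s) =
  let FZ-ok , GZ-ok = F-G-dyck s in
  subst IsDyck (sym (F-++UD {Z} (Shape⇒IsDyck s))) (dyck-++ {F Z} {UD} FZ-ok refl) ,
  subst IsDyck (sym (G-++UD Z)) (dyck-wrap {G Z} GZ-ok)
F-G-dyck (wrapped {S} s) =
  let FS-ok , GS-ok = F-G-dyck s in
  subst IsDyck (sym (F-wrap {S} (Shape⇒IsDyck s))) (dyck-wrap {G S} GS-ok) ,
  subst IsDyck (sym (G-wrap {S} (Shape⇒IsDyck s))) (dyck-++ {F S} {UD} FS-ok refl)
F-G-dyck (joined {X} {S} sX X≢[] sS S≢[]) = F-ok , subst IsDyck (sym (G≡F-joined {X} {S} X-ok X≢[] S-ok S≢[])) F-ok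
  where
  X-ok : IsDyck X
  X-ok = Shape⇒IsDyck sX
  S-ok : IsDyck S
  S-ok = Shape⇒IsDyck sS
  F-ok : IsDyck (F (X ++ wrap S))
  F-ok = subst IsDyck (sym (F-joined {X} {S} X-ok S-ok))
    (dyck-++ {F X} {wrap (G S)} (proj₁ (F-G-dyck sX)) (dyck-wrap {G S} (proj₂ (F-G-dyck sS))))

F-G-≢[] : ∀ {Y} → Shape Y → Y ≢ [] → F Y ≢ [] × G Y ≢ []
F-G-≢[] empty []≢[] = contradiction refl []≢[]
F-G-≢[] (endsUD {Z} s) _ =
  subst (_≢ []) (sym (F-++UD {Z} (Shape⇒IsDyck s))) (++-≢[]ʳ {xs = F Z} λ ()) ,
  subst (_≢ []) (sym (G-++UD Z)) λ ()
F-G-≢[] (wrapped {S} s) _ =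
  subst (_≢ []) (sym (F-wrap {S} (Shape⇒IsDyck s))) (λ ()) ,
  subst (_≢ []) (sym (G-wrap {S} (Shape⇒IsDyck s))) (++-≢[]ʳ {xs = F S} λ ())
F-G-≢[] (joined {X} {S} sX X≢[] sS S≢[]) _ = F≢[] , subst (_≢ []) (sym (G≡F-joined {X} {S} X-ok X≢[] S-ok S≢[])) F≢[]
  where
  X-ok : IsDyck X
  X-ok = Shape⇒IsDyck sX
  S-ok : IsDyck S
  S-ok = Shape⇒IsDyck sS
  F≢[] : F (X ++ wrap S) ≢ []
  F≢[] = subst (_≢ []) (sym (F-joined {X} {S} X-ok S-ok)) (++-≢[]ʳ {xs = F X} λ ())

F-nonEmptyDyck : ∀ {Y} → NonEmptyDyck Y → NonEmptyDyck (F Y)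
F-nonEmptyDyck {Y} (Y-ok , Y≢[]) = proj₁ (F-G-dyck (shape {Y} Y-ok)) , proj₁ (F-G-≢[] (shape {Y} Y-ok) Y≢[])

G-nonEmptyDyck : ∀ {Y} → NonEmptyDyck Y → NonEmptyDyck (G Y)
G-nonEmptyDyck {Y} (Y-ok , Y≢[]) = proj₂ (F-G-dyck (shape {Y} Y-ok)) , proj₂ (F-G-≢[] (shape {Y} Y-ok) Y≢[])

gen : Bool → List Step → List Step
gen false = F
gen true = G

act : List Bool → List Step → List Step
act [] y = y
act (b ∷ w) y = gen b (act w y)

emb : Bool → List Step → List Step
emb false Z = Z ++ UD
emb true Z = wrap Z

dyck-gen : ∀ b {Y} → IsDyck Y → IsDyck (gen b Y)
dyck-gen false {Y} Y-ok = proj₁ (F-G-dyck (shape {Y} Y-ok))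
dyck-gen true {Y} Y-ok = proj₂ (F-G-dyck (shape {Y} Y-ok))

dyck-act : ∀ w {Y} → IsDyck Y → IsDyck (act w Y)
dyck-act [] Y-ok = Y-ok
dyck-act (b ∷ w) Y-ok = dyck-gen b (dyck-act w Y-ok)

act-++ : ∀ u v y → act (u ++ v) y ≡ act u (act v y)
act-++ [] v y = refl
act-++ (b ∷ u) v y = cong (gen b) (act-++ u v y)

act-[] : ∀ w → act w [] ≡ []
act-[] [] = refl
act-[] (false ∷ w) = cong F (act-[] w)
act-[] (true ∷ w) = cong G (act-[] w)

gen-emb : ∀ b t {Z} → IsDyck Z → gen b (emb t Z) ≡ emb (b xor t) (gen (b xor t) Z)
gen-emb false false {Z} Z-ok = F-++UD {Z} Z-ok
gen-emb false true {Z} Z-ok = F-wrap {Z} Z-ok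
gen-emb true false {Z} _ = G-++UD Z
gen-emb true true {Z} Z-ok = G-wrap {Z} Z-ok

tag : List Bool → Bool → Bool
tag w t = foldr _xor_ t w

inside : List Bool → Bool → List Bool
inside [] t = []
inside (b ∷ w) t = tag (b ∷ w) t ∷ inside w t

act-emb : ∀ w t {Z} → IsDyck Z → act w (emb t Z) ≡ emb (tag w t) (act (inside w t) Z)
act-emb [] t Z-ok = refl
act-emb (b ∷ w) t Z-ok =
  trans (cong (gen b) (act-emb w t Z-ok)) (gen-emb b (tag w t) (dyck-act (inside w t) Z-ok))

tag-involutive : ∀ w t → tag w (tag w t) ≡ t
tag-involutive w t = begin
  tag w (tag w t)                ≡⟨ tag-xor w (tag w t) ⟩
  parity xor tag w t             ≡⟨ cong (parity xor_) (tag-xor w t) ⟩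
  parity xor (parity xor t)      ≡⟨ xor-assoc parity parity t ⟨
  (parity xor parity) xor t      ≡⟨ cong (_xor t) (xor-same parity) ⟩
  t                              ∎
  where
  open ≡-Reasoning
  parity : Bool
  parity = tag w false
  tag-xor : ∀ w t → tag w t ≡ tag w false xor t
  tag-xor [] t = refl
  tag-xor (b ∷ w) t = trans (cong (b xor_) (tag-xor w t)) (sym (xor-assoc b (tag w false) t))

act²-emb : ∀ w t {Z} → IsDyck Z → act w (act w (emb t Z)) ≡ emb t (act (inside w (tag w t) ++ inside w t) Z)
act²-emb w t {Z} Z-ok = begin
  act w (act w (emb t Z))                                         ≡⟨ cong (act w) (act-emb w t Z-ok) ⟩
  act w (emb (tag w t) (act (inside w t) Z))                      ≡⟨ act-emb w (tag w t) (dyck-act (inside w t) Z-ok) ⟩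
  emb (tag w (tag w t)) (act (inside w (tag w t)) (act (inside w t) Z)) ≡⟨ cong₂ emb (tag-involutive w t) (sym (act-++ (inside w (tag w t)) (inside w t) Z)) ⟩
  emb t (act (inside w (tag w t) ++ inside w t) Z)                ∎
  where open ≡-Reasoning

gen-joined : ∀ b {X S} → NonEmptyDyck X → NonEmptyDyck S → gen b (X ++ wrap S) ≡ F X ++ wrap (G S)
gen-joined false {X} {S} (X-ok , _) (S-ok , _) = F-joined {X} {S} X-ok S-ok
gen-joined true {X} {S} (X-ok , X≢[]) (S-ok , S≢[]) = trans (G≡F-joined {X} {S} X-ok X≢[] S-ok S≢[]) (F-joined {X} {S} X-ok S-ok)

act-joined : ∀ w {X S} → NonEmptyDyck X → NonEmptyDyck S →
  act w (X ++ wrap S) ≡ iter F (length w) X ++ wrap (iter G (length w) S)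
act-joined [] X-ok S-ok = refl
act-joined (b ∷ w) X-ok S-ok = trans (cong (gen b) (act-joined w X-ok S-ok))
  (gen-joined b (iter-preserves NonEmptyDyck F-nonEmptyDyck (length w) X-ok) (iter-preserves NonEmptyDyck G-nonEmptyDyck (length w) S-ok))

iter-act-joined : ∀ w n {X S} → NonEmptyDyck X → NonEmptyDyck S →
  iter (act w) n (X ++ wrap S) ≡ iter F (n * length w) X ++ wrap (iter G (n * length w) S)
iter-act-joined w zero X-ok S-ok = refl
iter-act-joined w (suc n) {X} {S} X-ok S-ok = begin
  act w (iter (act w) n (X ++ wrap S))                                ≡⟨ cong (act w) (iter-act-joined w n X-ok S-ok) ⟩
  act w (iter F (n * L) X ++ wrap (iter G (n * L) S))                 ≡⟨ act-joined w (iter-preserves NonEmptyDyck F-nonEmptyDyck (n * L) X-ok) (iter-preserves NonEmptyDyck G-nonEmptyDyck (n * L) S-ok) ⟩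
  iter F L (iter F (n * L) X) ++ wrap (iter G L (iter G (n * L) S))   ≡⟨ cong₂ (λ a b → a ++ wrap b) (iter-+ F L (n * L) X) (iter-+ G L (n * L) S) ⟨
  iter F (L + n * L) X ++ wrap (iter G (L + n * L) S)                 ∎
  where
  open ≡-Reasoning
  L : ℕ
  L = length w

joined-periodic : ∀ w {X S} k₁ k₂ → NonEmptyDyck X → NonEmptyDyck S →
  iter F (2 ^ k₁) X ≡ X → iter G (2 ^ k₂) S ≡ S → iter (act w) (2 ^ (k₁ + k₂)) (X ++ wrap S) ≡ X ++ wrap S
joined-periodic w {X} {S} k₁ k₂ X-ok S-ok X-fixed S-fixed = trans (iter-act-joined w (2 ^ (k₁ + k₂)) X-ok S-ok)
  (cong₂ (λ a b → a ++ wrap b)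
    (iter-fixed-∣ F X-fixed (∣m⇒∣m*n (length w) (subst (2 ^ k₁ ∣_) 2^[k₁+k₂] (m∣m*n (2 ^ k₂)))))
    (iter-fixed-∣ G S-fixed (∣m⇒∣m*n (length w) (subst (2 ^ k₂ ∣_) 2^[k₁+k₂] (n∣m*n (2 ^ k₁))))))
  where
  2^[k₁+k₂] : 2 ^ k₁ * 2 ^ k₂ ≡ 2 ^ (k₁ + k₂)
  2^[k₁+k₂] = sym (^-distribˡ-+-* 2 k₁ k₂)

emb-periodic : ∀ w t k {Z} → IsDyck Z → iter (act (inside w (tag w t) ++ inside w t)) (2 ^ k) Z ≡ Z →
  iter (act w) (2 ^ suc k) (emb t Z) ≡ emb t Z
emb-periodic w t k {Z} Z-ok Z-fixed = begin
  iter (act w) (2 * 2 ^ k) (emb t Z)            ≡⟨ cong (λ n → iter (act w) n (emb t Z)) (*-comm 2 (2 ^ k)) ⟩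
  iter (act w) (2 ^ k * 2) (emb t Z)            ≡⟨ iter-* (act w) (2 ^ k) 2 (emb t Z) ⟩
  iter (iter (act w) 2) (2 ^ k) (emb t Z)       ≡⟨ iter-semiconj IsDyck {e = emb t} (λ {z} → dyck-act w′ {z}) (λ {z} → act²-emb w t {z}) (2 ^ k) Z-ok ⟩
  emb t (iter (act w′) (2 ^ k) Z)               ≡⟨ cong (emb t) Z-fixed ⟩
  emb t Z                                       ∎
  where
  open ≡-Reasoning
  w′ : List Bool
  w′ = inside w (tag w t) ++ inside w t

act-periodic : ∀ {Y} → Shape Y → ∀ w → PowerOfTwoPeriodic (act w) Y
act-periodic empty w = 0 , act-[] w
act-periodic (endsUD {Z} s) w with act-periodic s (inside w (tag w false) ++ inside w false)
... | k , Z-fixed = suc k , emb-periodic w false k (Shape⇒IsDyck s) Z-fixed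
act-periodic (wrapped s) w with act-periodic s (inside w (tag w true) ++ inside w true)
... | k , S-fixed = suc k , emb-periodic w true k (Shape⇒IsDyck s) S-fixed
act-periodic (joined sX X≢[] sS S≢[]) w with act-periodic sX (false ∷ []) | act-periodic sS (true ∷ [])
... | k₁ , X-fixed | k₂ , S-fixed =
  k₁ + k₂ , joined-periodic w k₁ k₂ (Shape⇒IsDyck sX , X≢[]) (Shape⇒IsDyck sS , S≢[]) X-fixed S-fixed

_≟ₛ_ : DecidableEquality Step
U ≟ₛ U = yes refl
U ≟ₛ D = no λ ()
D ≟ₛ U = no λ ()
D ≟ₛ D = yes refl

mainTheorem1 : (P : List Step) → IsDyck P →
    ∃[ k ] ∃[ L ] (Unique L × length L ≡ 2 ^ k ×
      ((X : List Step) → (X ∈ L ⇔ (∃[ m ] iter F m P ≡ X))))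
mainTheorem1 P P-ok = orbit-size-2^ F P (≡-dec _≟ₛ_) (act-periodic (shape {P} P-ok) (false ∷ []))
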